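{- Let $W$ be an eventually periodic subset of $\mathbb{Z}$. Then $W$ admits no minimal asymptotic complement in $\mathbb{Z}$.
   Context: A nonempty bounded below subset $A\subseteq\mathbb{Z}$ is eventually periodic (with period $T$) if there is a positive integer $T$ such that $a+T\in A$ for all sufficiently large $a\in A$. For nonempty $A,B\subseteq\mathbb{Z}$, $A+B=\{a+b: a\in A,b\in B\}$. Given nonempty $W,C\subseteq \mathbb{Z}$, $C$ is an asymptotic complement to $W$ if $\mathbb{Z}\setminus(W+C)$ is finite, and a minimal asymptotic complement if it is an asymptotic complement but $C\setminus\{c\}$ is not an asymptotic complement for every $c\in C$. -}

module Defs where

open import Data.Integer using (ℤ; _+_; _≤_; _<_; 0ℤ)
open import Data.Product using (Σ; ∃; _×_; _,_)
open import Data.List using (List)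
open import Data.List.Membership.Propositional using (_∈_)
open import Relation.Binary.PropositionalEquality using (_≡_; _≢_)
open import Relation.Nullary using (¬_)

Subset : Set₁
Subset = ℤ → Set

Nonempty : Subset → Set
Nonempty A = ∃ λ a → A a

BoundedBelow : Subset → Set
BoundedBelow A = ∃ λ m → ∀ a → A a → m ≤ a

Finite : Subset → Set
Finite S = ∃ λ (L : List ℤ) → ∀ z → S z → z ∈ L

EventuallyPeriodic : Subset → Set
EventuallyPeriodic A =
  Nonempty A × BoundedBelow A ×
  (∃ λ T → (0ℤ < T) × (∃ λ N → ∀ a → A a → N ≤ a → A (a + T)))

_⊕_ : Subset → Subset → Subset
(A ⊕ B) z = ∃ λ a → ∃ λ b → A a × B b × z ≡ a + b

∁ : Subset → Subset
∁ S z = ¬ S z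

_∖_ : Subset → ℤ → Subset
(C ∖ c) x = C x × x ≢ c

IsAsymptoticComplement : Subset → Subset → Set
IsAsymptoticComplement W C = Nonempty W × Nonempty C × Finite (∁ (W ⊕ C))

IsMinimalAsymptoticComplement : Subset → Subset → Set
IsMinimalAsymptoticComplement W C =
  IsAsymptoticComplement W C ×
  (∀ c → C c → ¬ IsAsymptoticComplement W (C ∖ c))

module Submission where

-- Let W be bounded below by m and satisfy w ∈ W, w ≥ N ⇒ w + T ∈ W, with
-- T > 0, and let C be a minimal asymptotic complement of W.
--  * Redundancy: if c, c' ∈ C are distinct and c = c' + kT with k ≥ 0, then
--    C ∖ {c} is still an asymptotic complement: a sum w + c with w ≥ N equals
--    (w + kT) + c', and the sums w + c with m ≤ w < N form a finite interval.
--    Hence, by minimality, distinct elements of C have distinct residues mod T.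
--  * Unboundedness: since W is bounded below and W + C is cofinite, C has
--    elements below every bound (in the double-negated sense; the argument is
--    constructive throughout).
--  * Pigeonhole: a set unbounded below cannot be mapped injectively into
--    {0, …, T-1}; by induction on k, below some bound all its values are ≥ k.

open import Defs
open import Relation.Nullary using (¬_)
open import Data.Product using (∃)

open import Data.Nat as ℕ using (ℕ; zero; suc; NonZero; z≤n)
import Data.Nat.Properties as ℕP
open import Data.Integer as ℤ
  using (ℤ; +_; +[1+_]; -[1+_]; _+_; _*_; _-_; -_; _≤_; _<_; 0ℤ; 1ℤ; _⊓_; +<+; pred; ∣_∣; -≤+; _≤?_; _≟_)
open import Data.Integer.Properties
open import Data.Integer.DivMod using (_%ℕ_; _/ℕ_; a≡a%ℕn+[a/ℕn]*n; n%ℕd<d)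
open import Data.Integer.Tactic.RingSolver using (solve-∀)
open import Data.Product using (_×_; _,_; proj₁)
open import Data.Sum using (_⊎_; inj₁; inj₂)
open import Data.List using (List; []; _∷_; _++_)
open import Data.List.Membership.Propositional using (_∈_)
open import Data.List.Membership.DecPropositional _≟_ using (_∈?_)
open import Data.List.Membership.Propositional.Properties using (∈-++⁺ˡ; ∈-++⁺ʳ)
open import Data.List.Relation.Unary.Any using (here; there)
open import Relation.Binary.PropositionalEquality using (_≡_; _≢_; refl; sym; trans; cong; subst; module ≡-Reasoning)
open import Relation.Nullary using (Dec; yes; no)
open import Relation.Nullary.Decidable using (decidable-stable; ¬¬-excluded-middle)
open import Data.Empty using (⊥; ⊥-elim)
open import Function using (_∘_)

range : ℤ → ℕ → List ℤ
range lo zero    = []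
range lo (suc n) = lo ∷ range (ℤ.suc lo) n

∈-range : ∀ n lo x → lo ≤ x → x < lo + + n → x ∈ range lo n
∈-range zero    lo x lo≤x x<lo+0 = ⊥-elim (<⇒≱ (subst (x <_) (+-identityʳ lo) x<lo+0) lo≤x)
∈-range (suc n) lo x lo≤x x<lo+1+n with lo ≟ x
... | yes refl = here refl
... | no lo≢x  = there (∈-range n (ℤ.suc lo) x (i<j⇒suc[i]≤j (≤∧≢⇒< lo≤x lo≢x))
                         (subst (x <_) (shift-one lo (+ n)) x<lo+1+n))
  where
  shift-one : ∀ a k → a + (1ℤ + k) ≡ (1ℤ + a) + k
  shift-one = solve-∀

interval : ℤ → ℤ → List ℤ
interval lo hi = range lo ∣ hi - lo ∣

∈-interval : ∀ lo hi x → lo ≤ x → x < hi → x ∈ interval lo hi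
∈-interval lo hi x lo≤x x<hi = ∈-range ∣ hi - lo ∣ lo x lo≤x (<-≤-trans x<hi hi≤lo+∣hi-lo∣)
  where
  i≤+∣i∣ : ∀ i → i ≤ + ∣ i ∣
  i≤+∣i∣ (+ n)    = ≤-refl
  i≤+∣i∣ -[1+ n ] = -≤+

  hi≤lo+∣hi-lo∣ : hi ≤ lo + + ∣ hi - lo ∣
  hi≤lo+∣hi-lo∣ = subst (_≤ lo + + ∣ hi - lo ∣) (sym (cancel lo hi)) (+-monoʳ-≤ lo (i≤+∣i∣ (hi - lo)))
    where
    cancel : ∀ a b → b ≡ a + (b - a)
    cancel = solve-∀

strict-lower-bound : (L : List ℤ) (b : ℤ) → ∃ λ z → z < b × (∀ x → x ∈ L → z < x)
strict-lower-bound []      b = pred b , i≤pred[j]⇒i<j ≤-refl , λ _ ()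
strict-lower-bound (x ∷ L) b with strict-lower-bound L (b ⊓ x)
... | z , z<b⊓x , z<L = z , <-≤-trans z<b⊓x (i⊓j≤i b x) , below-x∷L
  where
  below-x∷L : ∀ y → y ∈ x ∷ L → z < y
  below-x∷L y (here refl) = <-≤-trans z<b⊓x (i⊓j≤j b x)
  below-x∷L y (there y∈L) = z<L y y∈L

-- Membership in a list is decidable, so a set covered by a list up to double
-- negation is finite.
finite-by-¬¬ : (S : Subset) (L : List ℤ) → (∀ z → S z → ¬ ¬ z ∈ L) → Finite S
finite-by-¬¬ S L covered = L , λ z Sz → decidable-stable (z ∈? L) (covered z Sz)

PeriodicFrom : ℤ → ℤ → Subset → Set
PeriodicFrom N T W = ∀ a → W a → N ≤ a → W (a + T)

periodic-shift : ∀ {N T W} → PeriodicFrom N (+ T) W →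
  ∀ k w → W w → N ≤ w → W (w + + k * + T) × N ≤ w + + k * + T
periodic-shift {N} {W = W} per zero w Ww N≤w =
  subst W (sym (+-identityʳ w)) Ww , subst (N ≤_) (sym (+-identityʳ w)) N≤w
periodic-shift {N} {T} {W} per (suc k) w Ww N≤w with periodic-shift per k w Ww N≤w
... | Ww+kT , N≤w+kT =
  subst W one-more (per _ Ww+kT N≤w+kT) ,
  subst (N ≤_) one-more (≤-trans N≤w+kT (i≤i+j _ (+ T)))
  where
  one-more : w + + k * + T + + T ≡ w + + suc k * + T
  one-more = distrib w (+ k) (+ T)
    where
    distrib : ∀ a j t → a + j * t + t ≡ a + (1ℤ + j) * t
    distrib = solve-∀

redundant : ∀ {W C N T c c' k} → BoundedBelow W → PeriodicFrom N (+ T) W →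
  IsAsymptoticComplement W C → C c' → c' ≢ c → c ≡ c' + + k * + T →
  IsAsymptoticComplement W (C ∖ c)
redundant {W} {C} {N} {T} {c} {c'} {k} (m , m≤W) per (neW , _ , L , cofinite) Cc' c'≢c c≡c'+kT =
  neW , (c' , Cc' , c'≢c) , finite-by-¬¬ _ (L ++ interval (m + c) (N + c)) covered
  where
  covered : ∀ z → ¬ (W ⊕ (C ∖ c)) z → ¬ ¬ z ∈ (L ++ interval (m + c) (N + c))
  covered z z∉W+C∖c z∉list = z∉list (∈-++⁺ˡ (cofinite z z∉W+C))
    where
    z∉W+C : ¬ (W ⊕ C) z
    z∉W+C (w , d , Ww , Cd , z≡w+d) with d ≟ c
    ... | no d≢c = z∉W+C∖c (w , d , Ww , (Cd , d≢c) , z≡w+d)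
    ... | yes refl with N ≤? w
    ...   | yes N≤w = z∉W+C∖c (w + + k * + T , c' , Ww+kT , (Cc' , c'≢c) , z≡w+kT+c')
      where
      Ww+kT : W (w + + k * + T)
      Ww+kT = proj₁ (periodic-shift per k w Ww N≤w)

      z≡w+kT+c' : z ≡ (w + + k * + T) + c'
      z≡w+kT+c' = begin
        z                     ≡⟨ z≡w+d ⟩
        w + c                 ≡⟨ cong (λ e → w + e) c≡c'+kT ⟩
        w + (c' + + k * + T)  ≡⟨ regroup w c' (+ k) (+ T) ⟩
        (w + + k * + T) + c'  ∎
        where
        open ≡-Reasoning
        regroup : ∀ a b j t → a + (b + j * t) ≡ (a + j * t) + b
        regroup = solve-∀
    ...   | no N≰w = z∉list (∈-++⁺ʳ L (∈-interval (m + c) (N + c) z m+c≤z z<N+c))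
      where
      m+c≤z : m + c ≤ z
      m+c≤z = subst (m + c ≤_) (sym z≡w+d) (+-monoˡ-≤ c (m≤W w Ww))

      z<N+c : z < N + c
      z<N+c = subst (_< N + c) (sym z≡w+d) (+-monoˡ-< c (≰⇒> N≰w))

same-residue : ∀ T .{{_ : NonZero T}} x y → x %ℕ T ≡ y %ℕ T →
  (∃ λ k → x ≡ y + + k * + T) ⊎ (∃ λ k → y ≡ x + + k * + T)
same-residue T x y same = by-sign ((x /ℕ T) - (y /ℕ T)) x≡y+dT
  where
  open ≡-Reasoning

  split-quotient : ∀ r q q' t → r + q * t ≡ (r + q' * t) + (q - q') * t
  split-quotient = solve-∀

  add-back : ∀ a j t → a ≡ (a + (- j) * t) + j * t
  add-back = solve-∀

  x≡y+dT : x ≡ y + ((x /ℕ T) - (y /ℕ T)) * + T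
  x≡y+dT = begin
    x                                 ≡⟨ a≡a%ℕn+[a/ℕn]*n x T ⟩
    + (x %ℕ T) + (x /ℕ T) * + T       ≡⟨ cong (λ r → + r + (x /ℕ T) * + T) same ⟩
    + (y %ℕ T) + (x /ℕ T) * + T       ≡⟨ split-quotient (+ (y %ℕ T)) (x /ℕ T) (y /ℕ T) (+ T) ⟩
    (+ (y %ℕ T) + (y /ℕ T) * + T) + ((x /ℕ T) - (y /ℕ T)) * + T
                                      ≡⟨ cong (_+ ((x /ℕ T) - (y /ℕ T)) * + T) (sym (a≡a%ℕn+[a/ℕn]*n y T)) ⟩
    y + ((x /ℕ T) - (y /ℕ T)) * + T   ∎

  by-sign : ∀ d → x ≡ y + d * + T → (∃ λ k → x ≡ y + + k * + T) ⊎ (∃ λ k → y ≡ x + + k * + T)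
  by-sign (+ k)    x≡y+kT = inj₁ (k , x≡y+kT)
  by-sign -[1+ k ] x≡y-jT = inj₂ (suc k , (begin
    y                                        ≡⟨ add-back y (+ suc k) (+ T) ⟩
    (y + (- + suc k) * + T) + + suc k * + T  ≡⟨ cong (_+ + suc k * + T) (sym x≡y-jT) ⟩
    x + + suc k * + T                        ∎))

minimal⇒residue-injective : ∀ {W C N T} .{{_ : NonZero T}} → BoundedBelow W →
  PeriodicFrom N (+ T) W → IsMinimalAsymptoticComplement W C →
  ∀ x y → C x → C y → x %ℕ T ≡ y %ℕ T → x ≡ y
minimal⇒residue-injective {T = T} bdd per (complement , minimal) x y Cx Cy same with x ≟ y
... | yes x≡y = x≡y
... | no x≢y with same-residue T x y same
...   | inj₁ (k , x≡y+kT) = ⊥-elim (minimal x Cx (redundant {k = k} bdd per complement Cy (x≢y ∘ sym) x≡y+kT))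
...   | inj₂ (k , y≡x+kT) = ⊥-elim (minimal y Cy (redundant {k = k} bdd per complement Cx x≢y y≡x+kT))

-- If W ≥ m and W ⊕ C is cofinite, then C is not bounded below: pick z
-- below b + m and below every exception; z = w + x forces x < b.
complement-unbounded-below : ∀ {W C} → BoundedBelow W → Finite (∁ (W ⊕ C)) →
  ∀ b → ¬ ¬ (∃ λ x → C x × x < b)
complement-unbounded-below {W} {C} (m , m≤W) (L , cofinite) b nothing-below
  with strict-lower-bound L (b + m)
... | z , z<b+m , z<L = z∉exceptions z∉W+C
  where
  z∉exceptions : ¬ ¬ (W ⊕ C) z
  z∉exceptions z∉W+C = <-irrefl refl (z<L z (cofinite z z∉W+C))

  z∉W+C : ¬ (W ⊕ C) z
  z∉W+C (w , x , Ww , Cx , z≡w+x) = nothing-below (x , Cx , ≰⇒> b≰x)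
    where
    b≰x : ¬ b ≤ x
    b≰x b≤x = <⇒≱ z<b+m (subst (b + m ≤_) (trans (+-comm x w) (sym z≡w+x)) (+-mono-≤ b≤x (m≤W w Ww)))

module Pigeonhole (P : Subset) {T : ℕ} (r : ℤ → ℕ) (r<T : ∀ x → r x ℕ.< T)
                  (r-injective : ∀ x y → P x → P y → r x ≡ r y → x ≡ y) where

  ValuesEventuallyAtLeast : ℕ → Set
  ValuesEventuallyAtLeast k = ∃ λ b → ∀ x → P x → x < b → k ℕ.≤ r x

  -- If the value k is attained below b, at x say, then by injectivity it is
  -- not attained below min(b, x); otherwise b already works for k + 1.
  raise : ∀ k → ValuesEventuallyAtLeast k → ¬ ¬ ValuesEventuallyAtLeast (suc k)
  raise k (b , k≤r) no-bound = ¬¬-excluded-middle (λ attained? → no-bound (next attained?))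
    where
    next : Dec (∃ λ x → P x × x < b × r x ≡ k) → ValuesEventuallyAtLeast (suc k)
    next (yes (x , Px , x<b , rx≡k)) = b ⊓ x , λ y Py y<b⊓x →
      ℕP.≤∧≢⇒< (k≤r y Py (<-≤-trans y<b⊓x (i⊓j≤i b x)))
        (λ k≡ry → <-irrefl (r-injective y x Py Px (trans (sym k≡ry) (sym rx≡k)))
                           (<-≤-trans y<b⊓x (i⊓j≤j b x)))
    next (no not-attained) = b , λ y Py y<b →
      ℕP.≤∧≢⇒< (k≤r y Py y<b) (λ k≡ry → not-attained (y , Py , y<b , sym k≡ry))

  values-eventually-at-least : ∀ k → ¬ ¬ ValuesEventuallyAtLeast k
  values-eventually-at-least zero    no-bound = no-bound (0ℤ , λ _ _ _ → z≤n)
  values-eventually-at-least (suc k) no-bound =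
    values-eventually-at-least k (λ bound → raise k bound no-bound)

  -- With k = T no element of P can lie below the bound, contradicting unboundedness.
  pigeonhole : (∀ b → ¬ ¬ (∃ λ x → P x × x < b)) → ⊥
  pigeonhole unbounded = values-eventually-at-least T λ where
    (b , T≤r) → unbounded b λ where
      (x , Px , x<b) → ℕP.<⇒≱ (r<T x) (T≤r x Px x<b)

-- The period is positive, hence of the form t + 1; residues modulo t + 1 are
-- injective on C (minimality) while C is unbounded below (cofiniteness).
lemma3p1 : (W : Subset) → EventuallyPeriodic W →
    ¬ (∃ λ C → IsMinimalAsymptoticComplement W C)
lemma3p1 W (_ , _ , + zero   , +<+ () , _) _
lemma3p1 W (_ , _ , -[1+ _ ] , ()     , _) _
lemma3p1 W (_ , bdd , +[1+ t ] , _ , _ , per) (C , minimal@((_ , _ , cofinite) , _)) =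
  Pigeonhole.pigeonhole C (_%ℕ T) (λ x → n%ℕd<d x T)
    (minimal⇒residue-injective bdd per minimal)
    (complement-unbounded-below bdd cofinite)
  where
  T : ℕ
  T = suc t
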